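{- Let $F=(V,E)$ be a forest. Then $$\sum_{S\subset V\text{ dominating set}}(-1)^{|S|}=(-1)^{\beta_1(F)+|V|}.$$
   Context: A set $S$ of vertices is dominating if every vertex is in $S$ or adjacent to a vertex of $S$. $\beta_1(F)$ is the matching number, the maximum number of pairwise disjoint edges of $F$. -}

module Defs where

open import Data.Nat using (ℕ; zero; suc; _≤_)
open import Data.Bool using (Bool; true; false)
import Data.Bool as Bool
open import Data.Fin using (Fin)
open import Data.Fin.Subset using (Subset; inside; outside; _∈_; ∣_∣)
open import Data.Fin.Subset.Properties using (_∈?_)
open import Data.Fin.Properties using (all?; any?)
open import Data.Vec using (_∷_; [])
open import Data.List using (List; []; _∷_; map; _++_; filter; foldr; length; concatMap; [_])
open import Data.List.Relation.Unary.All using (All)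
open import Data.List.Relation.Unary.Unique.Propositional using (Unique)
open import Data.List.Relation.Unary.Linked using (Linked)
open import Data.Product using (Σ; ∃-syntax; _×_; _,_)
open import Data.Sum using (_⊎_)
open import Data.Integer using (ℤ; _+_; 0ℤ; -1ℤ; _^_)
open import Relation.Nullary using (¬_; Dec)
open import Relation.Nullary.Decidable using (_⊎-dec_; _×-dec_)
open import Relation.Binary.PropositionalEquality using (_≡_)

record Graph (n : ℕ) : Set where
  field
    adj   : Fin n → Fin n → Bool
    sym   : ∀ u v → adj u v ≡ adj v u
    irrfl : ∀ v → adj v v ≡ false

open Graph public

Adj : ∀ {n} → Graph n → Fin n → Fin n → Set
Adj G u v = adj G u v ≡ true

IsCycle : ∀ {n} → Graph n → List (Fin n) → Set
IsCycle G [] = Data.Empty.⊥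
  where import Data.Empty
IsCycle G (v ∷ vs) =
  3 ≤ length (v ∷ vs) × Unique (v ∷ vs) × Linked (Adj G) ((v ∷ vs) ++ [ v ])

IsForest : ∀ {n} → Graph n → Set
IsForest G = ∀ cs → ¬ IsCycle G cs

Dominating : ∀ {n} → Graph n → Subset n → Set
Dominating G S = ∀ v → v ∈ S ⊎ ∃[ u ] (u ∈ S × Adj G u v)

dominating? : ∀ {n} (G : Graph n) (S : Subset n) → Dec (Dominating G S)
dominating? G S = all? λ v → (v ∈? S) ⊎-dec any? (λ u → (u ∈? S) ×-dec (adj G u v Bool.≟ true))

allSubsets : (n : ℕ) → List (Subset n)
allSubsets zero = [] ∷ []
allSubsets (suc n) = map (inside ∷_) (allSubsets n) ++ map (outside ∷_) (allSubsets n)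

sumℤ : List ℤ → ℤ
sumℤ = foldr _+_ 0ℤ

domSignSum : ∀ {n} → Graph n → ℤ
domSignSum {n} G = sumℤ (map (λ S → -1ℤ ^ ∣ S ∣) (filter (dominating? G) (allSubsets n)))

endpoints : ∀ {n} → List (Fin n × Fin n) → List (Fin n)
endpoints = concatMap (λ { (u , v) → u ∷ v ∷ [] })

IsMatching : ∀ {n} → Graph n → List (Fin n × Fin n) → Set
IsMatching G M = All (λ { (u , v) → Adj G u v }) M × Unique (endpoints M)

-- m is the matching number β₁(G): the maximum size of a matching.
IsMatchingNumber : ∀ {n} → Graph n → ℕ → Set
IsMatchingNumber G m =
  (Σ _ λ M → IsMatching G M × length M ≡ m) × (∀ M → IsMatching G M → length M ≤ m)

module Submission where

-- Write D(W) for the signed count of dominating sets of the subgraph G[W] induced by a vertex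
-- set W. For a forest, D(W) = (-1)^(ν(G[W]) + |W|) for every W, by well-founded induction on W:
-- a nonempty vertex set of a forest contains a vertex v of degree at most one in G[W].
-- * If v is isolated, every dominating set contains v, and removing v gives D(W) = -D(W - v),
--   while the matching number is unchanged.
-- * If v is pendant at u, toggling v is a sign-reversing involution on the dominating sets
--   containing u. The other dominating sets contain v, and removing v from them gives exactly
--   the dominating sets of G[W - v - u], so D(W) = -D(W - v - u). Deleting the edge uv lowers
--   the matching number by one.

open import Defs
open import Data.Nat using (ℕ; _+_)
open import Data.Integer using (-1ℤ; _^_)
open import Relation.Binary.PropositionalEquality using (_≡_)

open import Level using (0ℓ)
open import Function using (id; _∘_; _⇔_; mk⇔; Equivalence)
open import Function.Construct.Composition using (_⇔-∘_)
open import Data.Bool using (Bool; true; false; not; if_then_else_)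
import Data.Bool as Bool
open import Data.Bool.Properties using (not-involutive)
open import Data.Nat using (zero; suc; _≤_; _≤?_; z≤n; s≤s)
open import Data.Nat.Properties
  using (≤-antisym; ≤-trans; ≤-reflexive; ≰⇒>; <⇒≱; m≤n⇒m≤1+n; +-suc)
  renaming (+-identityʳ to ℕ-+-identityʳ)
open import Data.Integer using (ℤ; +_; -[1+_]; 0ℤ; 1ℤ; -_; _*_) renaming (_+_ to _+ᶻ_)
open import Data.Integer.Properties
  using ( +-assoc; +-comm; +-identityˡ; +-identityʳ; +-commutativeSemigroup; neg-involutive
        ; neg-distrib-+; neg-distribˡ-*; neg-distribʳ-*; -1*i≡-i; ^-distribˡ-+-*)
open import Algebra.Properties.CommutativeSemigroup +-commutativeSemigroup using (interchange)
open import Data.Fin using (Fin; zero; suc; _≟_)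
open import Data.Fin.Properties using (any?; pigeonhole; <⇒≢)
open import Data.Fin.Subset
  using (Subset; inside; outside; _∈_; _∉_; _⊆_; _⊂_; ∣_∣; ⊥; ⊤; _-_; Nonempty; Empty)
open import Data.Fin.Subset.Properties
  using ( _∈?_; _⊆?_; Lift?; nonempty?; ∈⊤; ∉⊥; ⊥⊆; Empty-unique; ∣⊥∣≡0; ∣⊤∣≡n
        ; ⊂-trans; p─⊥≡p; p─q⊆p; x∈p∧x≢y⇒x∈p-y; x∈p⇒p-x⊂p)
open import Data.Fin.Subset.Induction using (Acc; acc; ⊂-wellFounded)
open import Data.Vec using ([]; _∷_; _[_]%=_; here; there)
open import Data.Vec.Properties
  using (updateAt-updateAt-local; updateAt-id; updateAt-minimal; updateAt-updates; []=-injective)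
open import Data.List using (List; []; _∷_; _++_; [_]; map; filter; length)
import Data.List as List
open import Data.List.Properties using (map-++; map-∘)
open import Data.List.Relation.Unary.All as All using (All; []; _∷_)
open import Data.List.Relation.Unary.All.Properties
  using (¬Any⇒All¬; All¬⇒¬Any; anti-mono; ++⁻ˡ; ++⁻ʳ)
open import Data.List.Relation.Unary.Any using (here; there)
open import Data.List.Relation.Unary.AllPairs using ([]; _∷_)
open import Data.List.Relation.Unary.Unique.Propositional using (Unique)
open import Data.List.Relation.Unary.Linked using (Linked; [-]; _∷_)
open import Data.List.Membership.Propositional using () renaming (_∈_ to _∈ₗ_; _∉_ to _∉ₗ_)
open import Data.List.Membership.Propositional.Properties using (∈-lookup; ∈-∃++)
open import Data.List.Relation.Binary.Subset.Propositional using () renaming (_⊆_ to _⊆ₗ_)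
open import Data.Product using (_×_; _,_; ∃-syntax; proj₁)
open import Data.Sum using (_⊎_; inj₁; inj₂; [_,_]′)
open import Relation.Nullary using (¬_; Dec; yes; no; does; contradiction)
open import Relation.Nullary.Decidable using (dec-true; dec-false; _⊎-dec_; _×-dec_; ¬?)
open import Relation.Unary using (Pred; Decidable)
open import Relation.Unary.Properties using (_∩?_; ∁?)
open import Relation.Binary.PropositionalEquality
  using (_≢_; refl; cong; cong₂; subst; trans; module ≡-Reasoning)
import Relation.Binary.PropositionalEquality as ≡

private
  variable
    n : ℕ

sumSubsets : (Subset n → ℤ) → ℤ
sumSubsets {zero}  f = f []
sumSubsets {suc n} f = sumSubsets (f ∘ (inside ∷_)) +ᶻ sumSubsets (f ∘ (outside ∷_))

sumSubsets-cong : {f g : Subset n → ℤ} → (∀ S → f S ≡ g S) → sumSubsets f ≡ sumSubsets g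
sumSubsets-cong {zero}  f≗g = f≗g []
sumSubsets-cong {suc n} f≗g =
  cong₂ _+ᶻ_ (sumSubsets-cong (f≗g ∘ (inside ∷_))) (sumSubsets-cong (f≗g ∘ (outside ∷_)))

sumSubsets-+ : (f g : Subset n → ℤ) → sumSubsets (λ S → f S +ᶻ g S) ≡ sumSubsets f +ᶻ sumSubsets g
sumSubsets-+ {zero}  f g = refl
sumSubsets-+ {suc n} f g = trans
  (cong₂ _+ᶻ_ (sumSubsets-+ (f ∘ (inside ∷_)) (g ∘ (inside ∷_)))
              (sumSubsets-+ (f ∘ (outside ∷_)) (g ∘ (outside ∷_))))
  (interchange (sumSubsets (f ∘ (inside ∷_))) (sumSubsets (g ∘ (inside ∷_)))
               (sumSubsets (f ∘ (outside ∷_))) (sumSubsets (g ∘ (outside ∷_))))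

sumSubsets-neg : (f : Subset n → ℤ) → sumSubsets (-_ ∘ f) ≡ - sumSubsets f
sumSubsets-neg {zero}  f = refl
sumSubsets-neg {suc n} f = trans
  (cong₂ _+ᶻ_ (sumSubsets-neg (f ∘ (inside ∷_))) (sumSubsets-neg (f ∘ (outside ∷_))))
  (≡.sym (neg-distrib-+ (sumSubsets (f ∘ (inside ∷_))) (sumSubsets (f ∘ (outside ∷_)))))

sumSubsets-zero : {f : Subset n → ℤ} → (∀ S → f S ≡ 0ℤ) → sumSubsets f ≡ 0ℤ
sumSubsets-zero {zero}  f≗0 = f≗0 []
sumSubsets-zero {suc n} f≗0 =
  cong₂ _+ᶻ_ (sumSubsets-zero (f≗0 ∘ (inside ∷_))) (sumSubsets-zero (f≗0 ∘ (outside ∷_)))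

sumSubsets-concentrated : {f : Subset n → ℤ} → (∀ S → Nonempty S → f S ≡ 0ℤ) →
                          sumSubsets f ≡ f ⊥
sumSubsets-concentrated {zero}      f≗0 = refl
sumSubsets-concentrated {suc n} {f} f≗0 = begin
  sumSubsets (f ∘ (inside ∷_)) +ᶻ sumSubsets (f ∘ (outside ∷_))
    ≡⟨ cong₂ _+ᶻ_
         (sumSubsets-zero λ S → f≗0 (inside ∷ S) (zero , here))
         (sumSubsets-concentrated λ { S (x , x∈S) → f≗0 (outside ∷ S) (suc x , there x∈S) }) ⟩
  0ℤ +ᶻ f ⊥
    ≡⟨ +-identityˡ (f ⊥) ⟩
  f ⊥ ∎
  where open ≡-Reasoning

toggle : Fin n → Subset n → Subset n
toggle v S = S [ v ]%= not

sumSubsets-toggle : (v : Fin n) (f : Subset n → ℤ) → sumSubsets (f ∘ toggle v) ≡ sumSubsets f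
sumSubsets-toggle zero    f = +-comm (sumSubsets (f ∘ (outside ∷_))) (sumSubsets (f ∘ (inside ∷_)))
sumSubsets-toggle (suc v) f =
  cong₂ _+ᶻ_ (sumSubsets-toggle v (f ∘ (inside ∷_))) (sumSubsets-toggle v (f ∘ (outside ∷_)))

toggle-involutive : (v : Fin n) (S : Subset n) → toggle v (toggle v S) ≡ S
toggle-involutive v S = trans (updateAt-updateAt-local v S (not-involutive _)) (updateAt-id v S)

∈-toggle-≢ : {x v : Fin n} {S : Subset n} → x ≢ v → x ∈ toggle v S ⇔ x ∈ S
∈-toggle-≢ {x = x} {v} {S} x≢v = mk⇔
  (λ x∈T → subst (x ∈_) (toggle-involutive v S) (updateAt-minimal x v (toggle v S) x≢v x∈T))
  (updateAt-minimal x v S x≢v)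

∈⇒∉-toggle : {v : Fin n} {S : Subset n} → v ∈ S → v ∉ toggle v S
∈⇒∉-toggle {v = v} {S} v∈S v∈T with () ← []=-injective (updateAt-updates v S v∈S) v∈T

∉-toggle⇒∈ : {v : Fin n} {S : Subset n} → v ∉ toggle v S → v ∈ S
∉-toggle⇒∈ {v = zero}  {S = inside  ∷ S} _    = here
∉-toggle⇒∈ {v = zero}  {S = outside ∷ S} v∉T = contradiction here v∉T
∉-toggle⇒∈ {v = suc v} {S = _       ∷ S} v∉T = there (∉-toggle⇒∈ (v∉T ∘ there))

x∉p-x : (x : Fin n) (p : Subset n) → x ∉ p - x
x∉p-x zero    (_ ∷ p) ()
x∉p-x (suc x) (_ ∷ p) (there x∈p-x) = x∉p-x x p x∈p-x

x∈p-y⇒x≢y : {x y : Fin n} {p : Subset n} → x ∈ p - y → x ≢ y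
x∈p-y⇒x≢y {x = x} {p = p} x∈p-x refl = x∉p-x x p x∈p-x

x∈p⇒p-x≡toggle : {x : Fin n} {p : Subset n} → x ∈ p → p - x ≡ toggle x p
x∈p⇒p-x≡toggle {x = zero}  {p = _ ∷ p} here        = cong (outside ∷_) (p─⊥≡p p)
x∈p⇒p-x≡toggle {x = suc x} {p = b ∷ p} (there x∈p) = cong (b ∷_) (x∈p⇒p-x≡toggle x∈p)

sign : Subset n → ℤ
sign S = -1ℤ ^ ∣ S ∣

sign-⊥ : ∀ n → sign (⊥ {n}) ≡ 1ℤ
sign-⊥ n = cong (-1ℤ ^_) (∣⊥∣≡0 n)

sign-inside : (S : Subset n) → sign (inside ∷ S) ≡ - sign S
sign-inside S = -1*i≡-i (sign S)

sign-toggle : (v : Fin n) (S : Subset n) → sign (toggle v S) ≡ - sign S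
sign-toggle zero    (inside  ∷ S) = begin
  sign S              ≡⟨ neg-involutive (sign S) ⟨
  - - sign S          ≡⟨ cong -_ (sign-inside S) ⟨
  - sign (inside ∷ S) ∎
  where open ≡-Reasoning
sign-toggle zero    (outside ∷ S) = sign-inside S
sign-toggle (suc v) (inside  ∷ S) = begin
  sign (inside ∷ toggle v S) ≡⟨ sign-inside (toggle v S) ⟩
  - sign (toggle v S)        ≡⟨ cong -_ (sign-toggle v S) ⟩
  - - sign S                 ≡⟨ cong -_ (sign-inside S) ⟨
  - sign (inside ∷ S)        ∎
  where open ≡-Reasoning
sign-toggle (suc v) (outside ∷ S) = sign-toggle v S

sign-remove : {v : Fin n} {W : Subset n} → v ∈ W → sign (W - v) ≡ - sign W
sign-remove {v = v} {W} v∈W = trans (cong sign (x∈p⇒p-x≡toggle v∈W)) (sign-toggle v W)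

if-does-⇔ : {A B : Set} (a? : Dec A) (b? : Dec B) {x y : ℤ} → A ⇔ B → x ≡ y →
            (if does a? then x else 0ℤ) ≡ (if does b? then y else 0ℤ)
if-does-⇔ (yes a) (yes b) _   x≡y = x≡y
if-does-⇔ (yes a) (no ¬b) A⇔B _   = contradiction (Equivalence.to A⇔B a) ¬b
if-does-⇔ (no ¬a) (yes b) A⇔B _   = contradiction (Equivalence.from A⇔B b) ¬a
if-does-⇔ (no ¬a) (no ¬b) _   _   = refl

neg-if : (b : Bool) (x : ℤ) → - (if b then x else 0ℤ) ≡ (if b then - x else 0ℤ)
neg-if true  x = refl
neg-if false x = refl

x≡-x⇒x≡0 : {x : ℤ} → x ≡ - x → x ≡ 0ℤ
x≡-x⇒x≡0 {+ zero}    _ = refl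
x≡-x⇒x≡0 {+ suc _}   ()
x≡-x⇒x≡0 { -[1+ _ ]} ()

signedTerm : {P : Pred (Subset n) 0ℓ} → Decidable P → Subset n → ℤ
signedTerm P? S = if does (P? S) then sign S else 0ℤ

signedSum : {P : Pred (Subset n) 0ℓ} → Decidable P → ℤ
signedSum P? = sumSubsets (signedTerm P?)

module _ {P Q : Pred (Subset n) 0ℓ} (P? : Decidable P) (Q? : Decidable Q) where

  signedSum-cong : (∀ S → P S ⇔ Q S) → signedSum P? ≡ signedSum Q?
  signedSum-cong P⇔Q = sumSubsets-cong λ S → if-does-⇔ (P? S) (Q? S) (P⇔Q S) refl

  signedTerm-toggle : (v : Fin n) (S : Subset n) → P S ⇔ Q (toggle v S) →
                      signedTerm P? S ≡ - signedTerm Q? (toggle v S)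
  signedTerm-toggle v S P⇔Q∘toggle = begin
    signedTerm P? S                           ≡⟨ if-does-⇔ (P? S) (Q? T) P⇔Q∘toggle sign-S ⟩
    (if does (Q? T) then - sign T else 0ℤ)    ≡⟨ neg-if (does (Q? T)) (sign T) ⟨
    - signedTerm Q? T                         ∎
    where
    open ≡-Reasoning
    T = toggle v S
    sign-S : sign S ≡ - sign T
    sign-S = trans (≡.sym (neg-involutive (sign S))) (cong -_ (≡.sym (sign-toggle v S)))

  signedSum-toggle : (v : Fin n) → (∀ S → P S ⇔ Q (toggle v S)) → signedSum P? ≡ - signedSum Q?
  signedSum-toggle v P⇔Q∘toggle = begin
    sumSubsets (signedTerm P?)
      ≡⟨ sumSubsets-cong (λ S → signedTerm-toggle v S (P⇔Q∘toggle S)) ⟩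
    sumSubsets (-_ ∘ signedTerm Q? ∘ toggle v)
      ≡⟨ sumSubsets-neg (signedTerm Q? ∘ toggle v) ⟩
    - sumSubsets (signedTerm Q? ∘ toggle v)
      ≡⟨ cong -_ (sumSubsets-toggle v (signedTerm Q?)) ⟩
    - sumSubsets (signedTerm Q?) ∎
    where open ≡-Reasoning

  signedSum-split : signedSum P? ≡ signedSum (P? ∩? Q?) +ᶻ signedSum (P? ∩? ∁? Q?)
  signedSum-split =
    trans (sumSubsets-cong split) (sumSubsets-+ (signedTerm (P? ∩? Q?)) (signedTerm (P? ∩? ∁? Q?)))
    where
    split : ∀ S → signedTerm P? S ≡ signedTerm (P? ∩? Q?) S +ᶻ signedTerm (P? ∩? ∁? Q?) S
    split S with P? S | Q? S
    ... | yes _ | yes _ = ≡.sym (+-identityʳ (sign S))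
    ... | yes _ | no _  = ≡.sym (+-identityˡ (sign S))
    ... | no _  | _     = refl

signedSum-involution : {P : Pred (Subset n) 0ℓ} (P? : Decidable P) (v : Fin n) →
                       (∀ S → P S ⇔ P (toggle v S)) → signedSum P? ≡ 0ℤ
signedSum-involution P? v P⇔P∘toggle = x≡-x⇒x≡0 (signedSum-toggle P? P? v P⇔P∘toggle)

signedSum-⊥ : {P : Pred (Subset n) 0ℓ} (P? : Decidable P) → (∀ {S} → P S → S ≡ ⊥) → P ⊥ →
              signedSum P? ≡ 1ℤ
signedSum-⊥ {n} {P} P? P⇒⊥ P⊥ = begin
  signedSum P?
    ≡⟨ sumSubsets-concentrated (λ S S≠∅ → cong (λ b → if b then sign S else 0ℤ)
                                               (dec-false (P? S) (¬P S≠∅))) ⟩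
  signedTerm P? ⊥
    ≡⟨ cong (λ b → if b then sign (⊥ {n}) else 0ℤ) (dec-true (P? ⊥) P⊥) ⟩
  sign (⊥ {n})
    ≡⟨ sign-⊥ n ⟩
  1ℤ ∎
  where
  open ≡-Reasoning
  ¬P : ∀ {S} → Nonempty S → ¬ P S
  ¬P (x , x∈S) PS = ∉⊥ (subst (x ∈_) (P⇒⊥ PS) x∈S)

sumℤ-++ : (xs ys : List ℤ) → sumℤ (xs ++ ys) ≡ sumℤ xs +ᶻ sumℤ ys
sumℤ-++ []       ys = ≡.sym (+-identityˡ (sumℤ ys))
sumℤ-++ (x ∷ xs) ys = trans (cong (x +ᶻ_) (sumℤ-++ xs ys)) (≡.sym (+-assoc x (sumℤ xs) (sumℤ ys)))

sumℤ-map-filter : {A : Set} {P : Pred A 0ℓ} (P? : Decidable P) (f : A → ℤ) (xs : List A) →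
  sumℤ (map f (filter P? xs)) ≡ sumℤ (map (λ x → if does (P? x) then f x else 0ℤ) xs)
sumℤ-map-filter P? f []       = refl
sumℤ-map-filter P? f (x ∷ xs) with does (P? x)
... | true  = cong (f x +ᶻ_) (sumℤ-map-filter P? f xs)
... | false = trans (sumℤ-map-filter P? f xs) (≡.sym (+-identityˡ _))

sumℤ-map-allSubsets : (f : Subset n → ℤ) → sumℤ (map f (allSubsets n)) ≡ sumSubsets f
sumℤ-map-allSubsets {zero}  f = +-identityʳ (f [])
sumℤ-map-allSubsets {suc n} f = begin
  sumℤ (map f (ins ++ outs))
    ≡⟨ cong sumℤ (map-++ f ins outs) ⟩
  sumℤ (map f ins ++ map f outs)
    ≡⟨ sumℤ-++ (map f ins) (map f outs) ⟩
  sumℤ (map f ins) +ᶻ sumℤ (map f outs)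
    ≡⟨ cong₂ _+ᶻ_ (cong sumℤ (map-∘ (allSubsets n))) (cong sumℤ (map-∘ (allSubsets n))) ⟨
  sumℤ (map (f ∘ (inside ∷_)) (allSubsets n)) +ᶻ sumℤ (map (f ∘ (outside ∷_)) (allSubsets n))
    ≡⟨ cong₂ _+ᶻ_ (sumℤ-map-allSubsets (f ∘ (inside ∷_)))
                  (sumℤ-map-allSubsets (f ∘ (outside ∷_))) ⟩
  sumSubsets f ∎
  where
  open ≡-Reasoning
  ins outs : List (Subset (suc n))
  ins  = map (inside ∷_) (allSubsets n)
  outs = map (outside ∷_) (allSubsets n)

sumℤ-filter-allSubsets : {P : Pred (Subset n) 0ℓ} (P? : Decidable P) →
                         sumℤ (map sign (filter P? (allSubsets n))) ≡ signedSum P?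
sumℤ-filter-allSubsets {n} P? =
  trans (sumℤ-map-filter P? sign (allSubsets n)) (sumℤ-map-allSubsets (signedTerm P?))

module _ {A : Set} where

  Unique-lookup-injective : {xs : List A} → Unique xs →
                            ∀ {i j} → List.lookup xs i ≡ List.lookup xs j → i ≡ j
  Unique-lookup-injective (_  ∷ _)    {zero}  {zero}  _  = refl
  Unique-lookup-injective (x≢ ∷ _)    {zero}  {suc j} eq = contradiction eq (All.lookup x≢ (∈-lookup j))
  Unique-lookup-injective (x≢ ∷ _)    {suc i} {zero}  eq =
    contradiction (≡.sym eq) (All.lookup x≢ (∈-lookup i))
  Unique-lookup-injective (_  ∷ uniq) {suc i} {suc j} eq = cong suc (Unique-lookup-injective uniq eq)

  Unique-++-∷⁻ : (xs : List A) {y : A} {ys : List A} → Unique (xs ++ y ∷ ys) → Unique (y ∷ xs)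
  Unique-++-∷⁻ []       _           = [] ∷ []
  Unique-++-∷⁻ (x ∷ xs) (x≢ ∷ uniq) with y≢ ∷ uniq′ ← Unique-++-∷⁻ xs uniq =
    ((λ y≡x → All.head (++⁻ʳ xs x≢) (≡.sym y≡x)) ∷ y≢) ∷ ++⁻ˡ xs x≢ ∷ uniq′

  Linked-++-∷⁻ : {R : A → A → Set} (xs : List A) {y : A} {ys : List A} →
                 Linked R (xs ++ y ∷ ys) → Linked R (xs ++ [ y ])
  Linked-++-∷⁻ []            _        = [-]
  Linked-++-∷⁻ (x ∷ [])      (r ∷ _)  = r ∷ [-]
  Linked-++-∷⁻ (x ∷ x′ ∷ xs) (r ∷ rs) = r ∷ Linked-++-∷⁻ (x′ ∷ xs) rs

Unique⇒length≤ : {xs : List (Fin n)} → Unique xs → length xs ≤ n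
Unique⇒length≤ {n} {xs} uniq with length xs ≤? n
... | yes ≤n = ≤n
... | no ≰n with i , j , i<j , eq ← pigeonhole (≰⇒> ≰n) (List.lookup xs) =
  contradiction (Unique-lookup-injective uniq eq) (<⇒≢ i<j)

module _ {n} (G : Graph n) where

  open import Data.List.Membership.DecPropositional (_≟_ {n}) using () renaming (_∈?_ to _∈ₗ?_)

  private
    Edges : Set
    Edges = List (Fin n × Fin n)

  Adj-sym : {u v : Fin n} → Adj G u v → Adj G v u
  Adj-sym {u} {v} = trans (Graph.sym G v u)

  Adj-irrefl : {v : Fin n} → ¬ Adj G v v
  Adj-irrefl {v} v~v with () ← trans (≡.sym (irrfl G v)) v~v

  Dominated : Subset n → Fin n → Set
  Dominated S w = w ∈ S ⊎ ∃[ u ] (u ∈ S × Adj G u w)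

  dominated? : (S : Subset n) → Decidable (Dominated S)
  dominated? S w = (w ∈? S) ⊎-dec any? (λ u → (u ∈? S) ×-dec (adj G u w Bool.≟ true))

  DominatingIn : Subset n → Pred (Subset n) 0ℓ
  DominatingIn W S = S ⊆ W × (∀ {w} → w ∈ W → Dominated S w)

  dominatingIn? : (W : Subset n) → Decidable (DominatingIn W)
  dominatingIn? W S = (S ⊆? W) ×-dec Lift? (dominated? S) W

  dominating⇔dominatingIn-⊤ : {S : Subset n} → Dominating G S ⇔ DominatingIn ⊤ S
  dominating⇔dominatingIn-⊤ =
    mk⇔ (λ dom → (λ {x} _ → ∈⊤) , λ {w} _ → dom w) (λ (_ , dom) w → dom ∈⊤)

  domSum : Subset n → ℤ
  domSum W = signedSum (dominatingIn? W)

  domSum-empty : {W : Subset n} → Empty W → domSum W ≡ 1ℤ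
  domSum-empty {W} W≡∅ = signedSum-⊥ (dominatingIn? W)
    (λ (S⊆W , _) → Empty-unique λ (x , x∈S) → W≡∅ (x , S⊆W x∈S))
    (⊥⊆ , λ {w} w∈W → contradiction (w , w∈W) W≡∅)

  Dominated-toggle : {S : Subset n} {v w : Fin n} → w ≢ v → ¬ Adj G v w →
                     Dominated (toggle v S) w ⇔ Dominated S w
  Dominated-toggle {S} {v} {w} w≢v v≁w =
    mk⇔ (transfer (Equivalence.to ∘ ∈-toggle-≢)) (transfer (Equivalence.from ∘ ∈-toggle-≢))
    where
    transfer : {S S′ : Subset n} → (∀ {x} → x ≢ v → x ∈ S → x ∈ S′) →
               Dominated S w → Dominated S′ w
    transfer S⊆S′ (inj₁ w∈S)             = inj₁ (S⊆S′ w≢v w∈S)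
    transfer S⊆S′ (inj₂ (u , u∈S , u~w)) = inj₂ (u , S⊆S′ u≢v u∈S , u~w)
      where
      u≢v : u ≢ v
      u≢v refl = v≁w u~w

  -- The hypotheses say that W′ is W minus the closed neighbourhood N[v] of v in G[W].
  -- A dominating set of G[W] meeting N[v] only in v must contain v, so toggling v turns
  -- these sets into the dominating sets of G[W′].
  module DeleteClosedNeighbourhood
    {W W′ : Subset n} {v : Fin n} (v∈W : v ∈ W) (W′⊆W-v : W′ ⊆ W - v)
    (v≁W′ : ∀ {x} → x ∈ W′ → ¬ Adj G v x)
    (W∖W′⊆N[v] : ∀ {x} → x ∈ W → x ∉ W′ → x ≢ v → Adj G v x)
    where

    InW′∪v : Subset n → Set
    InW′∪v S = ∀ {x} → x ∈ S → x ∈ W′ ⊎ x ≡ v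

    W′⊆W : W′ ⊆ W
    W′⊆W = p─q⊆p W _ ∘ W′⊆W-v

    ∈W′⇒≢v : ∀ {x} → x ∈ W′ → x ≢ v
    ∈W′⇒≢v = x∈p-y⇒x≢y ∘ W′⊆W-v

    dominatingIn-toggle : ∀ S → (DominatingIn W S × InW′∪v S) ⇔ DominatingIn W′ (toggle v S)
    dominatingIn-toggle S = mk⇔ forward backward
      where
      forward : DominatingIn W S × InW′∪v S → DominatingIn W′ (toggle v S)
      forward ((S⊆W , dom) , inW′∪v) = T⊆W′ , λ w∈W′ →
        Equivalence.from (Dominated-toggle (∈W′⇒≢v w∈W′) (v≁W′ w∈W′)) (dom (W′⊆W w∈W′))
        where
        v∈S : v ∈ S
        v∈S with dom v∈W
        ... | inj₁ v∈S = v∈S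
        ... | inj₂ (x , x∈S , x~v) with inW′∪v x∈S
        ...   | inj₁ x∈W′ = contradiction (Adj-sym x~v) (v≁W′ x∈W′)
        ...   | inj₂ refl = contradiction x~v Adj-irrefl
        T⊆W′ : toggle v S ⊆ W′
        T⊆W′ {x} x∈T with x ≟ v
        ... | yes refl = contradiction x∈T (∈⇒∉-toggle v∈S)
        ... | no x≢v with inW′∪v (Equivalence.to (∈-toggle-≢ x≢v) x∈T)
        ...   | inj₁ x∈W′ = x∈W′
        ...   | inj₂ x≡v  = contradiction x≡v x≢v
      backward : DominatingIn W′ (toggle v S) → DominatingIn W S × InW′∪v S
      backward (T⊆W′ , dom′) = (S⊆W , dom) , inW′∪v
        where
        v∈S : v ∈ S
        v∈S = ∉-toggle⇒∈ λ v∈T → ∈W′⇒≢v (T⊆W′ v∈T) refl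
        inW′∪v : InW′∪v S
        inW′∪v {x} x∈S with x ≟ v
        ... | yes x≡v = inj₂ x≡v
        ... | no x≢v  = inj₁ (T⊆W′ (Equivalence.from (∈-toggle-≢ x≢v) x∈S))
        S⊆W : S ⊆ W
        S⊆W x∈S with inW′∪v x∈S
        ... | inj₁ x∈W′ = W′⊆W x∈W′
        ... | inj₂ refl = v∈W
        dom : ∀ {w} → w ∈ W → Dominated S w
        dom {w} w∈W with w ≟ v | w ∈? W′
        ... | yes refl | _        = inj₁ v∈S
        ... | no w≢v   | yes w∈W′ =
          Equivalence.to (Dominated-toggle w≢v (v≁W′ w∈W′)) (dom′ w∈W′)
        ... | no w≢v   | no w∉W′  = inj₂ (v , v∈S , W∖W′⊆N[v] w∈W w∉W′ w≢v)

    signedSum-deleteClosedNeighbourhood : {P : Pred (Subset n) 0ℓ} (P? : Decidable P) →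
      (∀ S → P S ⇔ (DominatingIn W S × InW′∪v S)) → signedSum P? ≡ - domSum W′
    signedSum-deleteClosedNeighbourhood P? P⇔ =
      signedSum-toggle P? (dominatingIn? W′) v (λ S → dominatingIn-toggle S ⇔-∘ P⇔ S)

  MatchingIn : Subset n → Edges → Set
  MatchingIn W M = IsMatching G M × All (_∈ W) (endpoints M)

  IsMatchingNumberIn : Subset n → ℕ → Set
  IsMatchingNumberIn W m =
    (∃[ M ] MatchingIn W M × length M ≡ m) × (∀ M → MatchingIn W M → length M ≤ m)

  matchingNumberIn-empty : {W : Subset n} → Empty W → IsMatchingNumberIn W 0
  matchingNumberIn-empty {W} W≡∅ = ([] , (([] , []) , []) , refl) , none
    where
    none : ∀ M → MatchingIn W M → length M ≤ 0
    none []            _             = z≤n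
    none ((a , _) ∷ _) (_ , a∈W ∷ _) = contradiction (a , a∈W) W≡∅

  matchingNumberIn-⊤ : {m β : ℕ} → IsMatchingNumberIn ⊤ m → IsMatchingNumber G β → m ≡ β
  matchingNumberIn-⊤ ((M , (matching , _) , refl) , maximal) ((M′ , matching′ , refl) , maximal′) =
    ≤-antisym (maximal′ M matching) (maximal M′ (matching′ , All.tabulate (λ _ → ∈⊤)))

  endpoint-partner : {M : Edges} {x : Fin n} → IsMatching G M → x ∈ₗ endpoints M →
                     ∃[ y ] y ∈ₗ endpoints M × Adj G y x
  endpoint-partner {(a , b) ∷ M} (a~b ∷ _ , _) (here refl)         = b , there (here refl) , Adj-sym a~b
  endpoint-partner {(a , b) ∷ M} (a~b ∷ _ , _) (there (here refl)) = a , here refl , a~b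
  endpoint-partner {(a , b) ∷ M} (_ ∷ adj , _ ∷ _ ∷ uniq) (there (there x∈M))
    with y , y∈M , y~x ← endpoint-partner (adj , uniq) x∈M = y , there (there y∈M) , y~x

  MatchingIn-mono : {W W′ : Subset n} {M : Edges} → W ⊆ W′ →
                    MatchingIn W M → MatchingIn W′ M
  MatchingIn-mono W⊆W′ (matching , inW) = matching , All.map W⊆W′ inW

  MatchingIn-remove : {W : Subset n} {M : Edges} {x : Fin n} →
                      MatchingIn W M → x ∉ₗ endpoints M → MatchingIn (W - x) M
  MatchingIn-remove {M = M} (matching , inW) x∉M = matching ,
    All.zipWith (λ (y∈W , x≢y) → x∈p∧x≢y⇒x∈p-y y∈W (x≢y ∘ ≡.sym))
                (inW , ¬Any⇒All¬ (endpoints M) x∉M)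

  delete-covering-edge : {M : Edges} {u : Fin n} → IsMatching G M → u ∈ₗ endpoints M →
    ∃[ M′ ] IsMatching G M′ × u ∉ₗ endpoints M′ ×
            endpoints M′ ⊆ₗ endpoints M × length M ≡ suc (length M′)
  delete-covering-edge {(a , b) ∷ M} (_ ∷ adj , a∉ ∷ b∉ ∷ uniq) (here refl) =
    M , (adj , uniq) , All¬⇒¬Any (All.tail a∉) , (λ x∈M → there (there x∈M)) , refl
  delete-covering-edge {(a , b) ∷ M} (_ ∷ adj , a∉ ∷ b∉ ∷ uniq) (there (here refl)) =
    M , (adj , uniq) , All¬⇒¬Any b∉ , (λ x∈M → there (there x∈M)) , refl
  delete-covering-edge {(a , b) ∷ M} {u} (a~b ∷ adj , a∉ ∷ b∉ ∷ uniq) (there (there u∈M))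
    with M′ , (adj′ , uniq′) , u∉M′ , M′⊆M , len ← delete-covering-edge (adj , uniq) u∈M =
    (a , b) ∷ M′ ,
    (a~b ∷ adj′ ,
     (All.head a∉ ∷ anti-mono M′⊆M (All.tail a∉)) ∷ anti-mono M′⊆M b∉ ∷ uniq′) ,
    u∉ , ab∷M′⊆ab∷M , cong suc len
    where
    u∉ : u ∉ₗ endpoints ((a , b) ∷ M′)
    u∉ (here refl)          = All.lookup (All.tail a∉) u∈M refl
    u∉ (there (here refl))  = All.lookup b∉ u∈M refl
    u∉ (there (there u∈M′)) = u∉M′ u∈M′
    ab∷M′⊆ab∷M : endpoints ((a , b) ∷ M′) ⊆ₗ endpoints ((a , b) ∷ M)
    ab∷M′⊆ab∷M (here x≡a)            = here x≡a
    ab∷M′⊆ab∷M (there (here x≡b))    = there (here x≡b)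
    ab∷M′⊆ab∷M (there (there x∈M′)) = there (there (M′⊆M x∈M′))

  DomSumFormula : Subset n → Set
  DomSumFormula W = ∃[ m ] IsMatchingNumberIn W m × domSum W ≡ -1ℤ ^ m * sign W

  formula-empty : {W : Subset n} → Empty W → DomSumFormula W
  formula-empty {W} W≡∅ = 0 , matchingNumberIn-empty W≡∅ , (begin
    domSum W           ≡⟨ domSum-empty W≡∅ ⟩
    1ℤ                 ≡⟨ cong (1ℤ *_) (sign-⊥ n) ⟨
    1ℤ * sign (⊥ {n})  ≡⟨ cong (λ X → 1ℤ * sign X) (Empty-unique W≡∅) ⟨
    1ℤ * sign W        ∎)
    where open ≡-Reasoning

  Isolated : Subset n → Fin n → Set
  Isolated W v = ∀ {x} → x ∈ W → ¬ Adj G x v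

  module IsolatedVertex {W : Subset n} {v : Fin n} (v∈W : v ∈ W) (isolated : Isolated W v) where

    domSum-≡ : domSum W ≡ - domSum (W - v)
    domSum-≡ = signedSum-deleteClosedNeighbourhood (dominatingIn? W)
      λ S → mk⇔ (λ dom → dom , λ {x} → inW-v∪v dom {x}) proj₁
      where
      open DeleteClosedNeighbourhood v∈W id
        (λ x∈W-v v~x → isolated (p─q⊆p W _ x∈W-v) (Adj-sym v~x))
        (λ x∈W x∉W-v x≢v → contradiction (x∈p∧x≢y⇒x∈p-y x∈W x≢v) x∉W-v)
      inW-v∪v : ∀ {S} → DominatingIn W S → InW′∪v S
      inW-v∪v (S⊆W , _) {x} x∈S with x ≟ v
      ... | yes x≡v = inj₂ x≡v
      ... | no x≢v  = inj₁ (x∈p∧x≢y⇒x∈p-y (S⊆W x∈S) x≢v)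

    matchingNumber-≡ : {m : ℕ} → IsMatchingNumberIn (W - v) m → IsMatchingNumberIn W m
    matchingNumber-≡ ((M , M-in , len) , maximal) =
      (M , MatchingIn-mono (p─q⊆p W _) M-in , len) ,
      λ M′ M′-in → maximal M′ (MatchingIn-remove M′-in (v-uncovered M′-in))
      where
      v-uncovered : ∀ {M} → MatchingIn W M → v ∉ₗ endpoints M
      v-uncovered (matching , inW) v∈M with y , y∈M , y~v ← endpoint-partner matching v∈M =
        isolated (All.lookup inW y∈M) y~v

    formula : DomSumFormula (W - v) → DomSumFormula W
    formula (m , ν , eq) = m , matchingNumber-≡ ν , (begin
      domSum W                    ≡⟨ domSum-≡ ⟩
      - domSum (W - v)            ≡⟨ cong -_ eq ⟩
      - (-1ℤ ^ m * sign (W - v))  ≡⟨ cong (λ s → - (-1ℤ ^ m * s)) (sign-remove v∈W) ⟩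
      - (-1ℤ ^ m * - sign W)      ≡⟨ neg-distribʳ-* (-1ℤ ^ m) (- sign W) ⟩
      -1ℤ ^ m * - - sign W        ≡⟨ cong (-1ℤ ^ m *_) (neg-involutive (sign W)) ⟩
      -1ℤ ^ m * sign W            ∎)
      where open ≡-Reasoning

  record Pendant (W : Subset n) (v u : Fin n) : Set where
    field
      u∈W    : u ∈ W
      u~v    : Adj G u v
      only-u : ∀ {x} → x ∈ W → Adj G x v → x ≡ u

  module PendantVertex {W : Subset n} {v u : Fin n} (v∈W : v ∈ W) (pendant : Pendant W v u) where

    open Pendant pendant

    u≢v : u ≢ v
    u≢v refl = Adj-irrefl u~v

    u∈W-v : u ∈ W - v
    u∈W-v = x∈p∧x≢y⇒x∈p-y u∈W u≢v

    W-v-u⊆W : W - v - u ⊆ W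
    W-v-u⊆W = p─q⊆p W _ ∘ p─q⊆p (W - v) _

    W-v-u⊂W : W - v - u ⊂ W
    W-v-u⊂W = ⊂-trans (x∈p⇒p-x⊂p u∈W-v) (x∈p⇒p-x⊂p v∈W)

    sign-≡ : sign (W - v - u) ≡ sign W
    sign-≡ = begin
      sign (W - v - u)  ≡⟨ sign-remove u∈W-v ⟩
      - sign (W - v)    ≡⟨ cong -_ (sign-remove v∈W) ⟩
      - - sign W        ≡⟨ neg-involutive (sign W) ⟩
      sign W            ∎
      where open ≡-Reasoning

    ¬Adj-v : ∀ {x} → x ∈ W → x ≢ u → ¬ Adj G v x
    ¬Adj-v x∈W x≢u v~x = x≢u (only-u x∈W (Adj-sym v~x))

    covered-⇔ : ∀ S → (DominatingIn W S × u ∈ S) ⇔ (DominatingIn W (toggle v S) × u ∈ toggle v S)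
    covered-⇔ S = mk⇔ keep
      (λ covered → subst (λ S′ → DominatingIn W S′ × u ∈ S′) (toggle-involutive v S) (keep covered))
      where
      keep : ∀ {S} → DominatingIn W S × u ∈ S → DominatingIn W (toggle v S) × u ∈ toggle v S
      keep {S} ((S⊆W , dom) , u∈S) = (T⊆W , dom′) , u∈T
        where
        u∈T : u ∈ toggle v S
        u∈T = Equivalence.from (∈-toggle-≢ u≢v) u∈S
        T⊆W : toggle v S ⊆ W
        T⊆W {x} x∈T with x ≟ v
        ... | yes refl = v∈W
        ... | no x≢v   = S⊆W (Equivalence.to (∈-toggle-≢ x≢v) x∈T)
        dom′ : ∀ {w} → w ∈ W → Dominated (toggle v S) w
        dom′ {w} w∈W with w ≟ v | w ≟ u
        ... | yes refl | _        = inj₂ (u , u∈T , u~v)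
        ... | no _     | yes refl = inj₁ u∈T
        ... | no w≢v   | no w≢u   = Equivalence.from (Dominated-toggle w≢v (¬Adj-v w∈W w≢u)) (dom w∈W)

    ∈W-v-u : ∀ {x} → x ∈ W → x ≢ v → x ≢ u → x ∈ W - v - u
    ∈W-v-u x∈W x≢v x≢u = x∈p∧x≢y⇒x∈p-y (x∈p∧x≢y⇒x∈p-y x∈W x≢v) x≢u

    W∖W-v-u⊆N[v] : ∀ {x} → x ∈ W → x ∉ W - v - u → x ≢ v → Adj G v x
    W∖W-v-u⊆N[v] {x} x∈W x∉W-v-u x≢v with x ≟ u
    ... | yes refl = Adj-sym u~v
    ... | no x≢u   = contradiction (∈W-v-u x∈W x≢v x≢u) x∉W-v-u

    open DeleteClosedNeighbourhood v∈W (p─q⊆p (W - v) _)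
      (λ x∈W-v-u → ¬Adj-v (W-v-u⊆W x∈W-v-u) (x∈p-y⇒x≢y x∈W-v-u)) W∖W-v-u⊆N[v]

    uncovered-⇔ : ∀ S → (DominatingIn W S × u ∉ S) ⇔ (DominatingIn W S × InW′∪v S)
    uncovered-⇔ S = mk⇔
      (λ (dom , u∉S) → dom , λ {x} → inW-v-u∪v (proj₁ dom) u∉S {x})
      (λ (dom , inW′∪v) → dom , λ u∈S →
        [ (λ u∈W-v-u → x∈p-y⇒x≢y u∈W-v-u refl) , u≢v ]′ (inW′∪v u∈S))
      where
      inW-v-u∪v : S ⊆ W → u ∉ S → InW′∪v S
      inW-v-u∪v S⊆W u∉S {x} x∈S with x ≟ v | x ≟ u
      ... | yes x≡v | _        = inj₂ x≡v
      ... | no _    | yes refl = contradiction x∈S u∉S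
      ... | no x≢v  | no x≢u   = inj₁ (∈W-v-u (S⊆W x∈S) x≢v x≢u)

    domSum-≡ : domSum W ≡ - domSum (W - v - u)
    domSum-≡ = begin
      domSum W
        ≡⟨ signedSum-split (dominatingIn? W) (u ∈?_) ⟩
      signedSum (dominatingIn? W ∩? (u ∈?_)) +ᶻ signedSum (dominatingIn? W ∩? ∁? (u ∈?_))
        ≡⟨ cong₂ _+ᶻ_ (signedSum-involution (dominatingIn? W ∩? (u ∈?_)) v covered-⇔)
                      (signedSum-deleteClosedNeighbourhood (dominatingIn? W ∩? ∁? (u ∈?_)) uncovered-⇔) ⟩
      0ℤ +ᶻ - domSum (W - v - u)
        ≡⟨ +-identityˡ _ ⟩
      - domSum (W - v - u) ∎
      where open ≡-Reasoning

    MatchingIn-extend : {M : Edges} → MatchingIn (W - v - u) M → MatchingIn W ((u , v) ∷ M)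
    MatchingIn-extend ((adj , uniq) , inW-v-u) =
      (u~v ∷ adj , (u≢v ∷ All.map u∉ inW-v-u) ∷ All.map v∉ inW-v-u ∷ uniq) ,
      u∈W ∷ v∈W ∷ All.map W-v-u⊆W inW-v-u
      where
      u∉ : ∀ {x} → x ∈ W - v - u → u ≢ x
      u∉ x∈W-v-u refl = x∈p-y⇒x≢y x∈W-v-u refl
      v∉ : ∀ {x} → x ∈ W - v - u → v ≢ x
      v∉ x∈W-v-u refl = x∈p-y⇒x≢y (p─q⊆p (W - v) _ x∈W-v-u) refl

    MatchingIn-restrict : {M : Edges} → MatchingIn W M → u ∉ₗ endpoints M →
                          MatchingIn (W - v - u) M
    MatchingIn-restrict {M} M-in@(matching , inW) u∉M = MatchingIn-remove (MatchingIn-remove M-in v∉M) u∉M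
      where
      v∉M : v ∉ₗ endpoints M
      v∉M v∈M with y , y∈M , y~v ← endpoint-partner matching v∈M =
        u∉M (subst (_∈ₗ endpoints M) (only-u (All.lookup inW y∈M) y~v) y∈M)

    matchingNumber-suc : {m : ℕ} → IsMatchingNumberIn (W - v - u) m → IsMatchingNumberIn W (suc m)
    matchingNumber-suc {m} ((M , M-in , len) , maximal) =
      ((u , v) ∷ M , MatchingIn-extend M-in , cong suc len) , bound
      where
      bound : ∀ M′ → MatchingIn W M′ → length M′ ≤ suc m
      bound M′ M′-in@(matching′ , inW) with u ∈ₗ? endpoints M′
      ... | no u∉M′ = m≤n⇒m≤1+n (maximal M′ (MatchingIn-restrict M′-in u∉M′))
      ... | yes u∈M′
        with M″ , matching″ , u∉M″ , M″⊆M′ , len′ ← delete-covering-edge matching′ u∈M′ =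
        subst (_≤ suc m) (≡.sym len′)
              (s≤s (maximal M″ (MatchingIn-restrict (matching″ , anti-mono M″⊆M′ inW) u∉M″)))

    formula : DomSumFormula (W - v - u) → DomSumFormula W
    formula (m , ν , eq) = suc m , matchingNumber-suc ν , (begin
      domSum W                        ≡⟨ domSum-≡ ⟩
      - domSum (W - v - u)            ≡⟨ cong -_ eq ⟩
      - (-1ℤ ^ m * sign (W - v - u))  ≡⟨ cong (λ s → - (-1ℤ ^ m * s)) sign-≡ ⟩
      - (-1ℤ ^ m * sign W)            ≡⟨ neg-distribˡ-* (-1ℤ ^ m) (sign W) ⟩
      - (-1ℤ ^ m) * sign W            ≡⟨ cong (_* sign W) (-1*i≡-i (-1ℤ ^ m)) ⟨
      -1ℤ ^ suc m * sign W            ∎)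
      where open ≡-Reasoning

  Leaf : Subset n → Fin n → Set
  Leaf W v = Isolated W v ⊎ ∃[ u ] Pendant W v u

  module _ (forest : IsForest G) where

    private
      -- The path a ∷ b ∷ rest is listed from its newest end a; having no repeated vertex,
      -- it can be extended at most k more times.
      grow : {W : Subset n} (k : ℕ) {a b : Fin n} {rest : List (Fin n)} → a ∈ W → b ∈ W →
             Unique (a ∷ b ∷ rest) → Linked (Adj G) (a ∷ b ∷ rest) → n ≤ k + length rest →
             ∃[ v ] v ∈ W × Leaf W v
      grow {W} k {a} {b} {rest} a∈W b∈W uniq path@(a~b ∷ _) bound
        with any? (λ w → (w ∈? W) ×-dec (adj G w a Bool.≟ true) ×-dec ¬? (w ≟ b))
      ... | no ∄w = a , a∈W , inj₂ (b , record { u∈W = b∈W ; u~v = Adj-sym a~b ; only-u = only-b })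
        where
        only-b : ∀ {x} → x ∈ W → Adj G x a → x ≡ b
        only-b {x} x∈W x~a with x ≟ b
        ... | yes x≡b = x≡b
        ... | no x≢b  = contradiction (x , x∈W , x~a , x≢b) ∄w
      ... | yes (w , w∈W , w~a , w≢b) with w ∈ₗ? rest
      ...   | yes w∈rest with r₁ , r₂ , refl ← ∈-∃++ w∈rest =
        contradiction
          (s≤s (s≤s (s≤s z≤n)) , Unique-++-∷⁻ (a ∷ b ∷ r₁) uniq , w~a ∷ Linked-++-∷⁻ (a ∷ b ∷ r₁) path)
          (forest (w ∷ a ∷ b ∷ r₁))
      ...   | no w∉rest = extend k bound
        where
        uniq′ : Unique (w ∷ a ∷ b ∷ rest)
        uniq′ = ((λ { refl → Adj-irrefl w~a }) ∷ w≢b ∷ ¬Any⇒All¬ rest w∉rest) ∷ uniq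
        extend : (k : ℕ) → n ≤ k + length rest → ∃[ v ] v ∈ W × Leaf W v
        extend zero    bound =
          contradiction (Unique⇒length≤ uniq′) (<⇒≱ (s≤s (m≤n⇒m≤1+n (m≤n⇒m≤1+n bound))))
        extend (suc k) bound =
          grow k w∈W a∈W uniq′ (w~a ∷ path) (≤-trans bound (≤-reflexive (≡.sym (+-suc k (length rest)))))

    forest-leaf : {W : Subset n} → Nonempty W → ∃[ v ] v ∈ W × Leaf W v
    forest-leaf {W} (x , x∈W) with any? (λ y → (y ∈? W) ×-dec (adj G y x Bool.≟ true))
    ... | no ∄y = x , x∈W , inj₁ (λ y∈W y~x → ∄y (_ , y∈W , y~x))
    ... | yes (y , y∈W , y~x) =
      grow n y∈W x∈W ((y≢x ∷ []) ∷ [] ∷ []) (y~x ∷ [-]) (≤-reflexive (≡.sym (ℕ-+-identityʳ n)))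
      where
      y≢x : y ≢ x
      y≢x refl = Adj-irrefl y~x

    formula-forest : (W : Subset n) → DomSumFormula W
    formula-forest W = go W (⊂-wellFounded W)
      where
      go : (W : Subset n) → Acc _⊂_ W → DomSumFormula W
      go W (acc smaller) with nonempty? W
      ... | no W≡∅ = formula-empty W≡∅
      ... | yes W≢∅ with forest-leaf W≢∅
      ... | v , v∈W , inj₁ isolated =
        IsolatedVertex.formula v∈W isolated (go (W - v) (smaller (x∈p⇒p-x⊂p v∈W)))
      ... | v , v∈W , inj₂ (u , pendant) =
        PendantVertex.formula v∈W pendant (go (W - v - u) (smaller (PendantVertex.W-v-u⊂W v∈W pendant)))

corollary8p4 : ∀ {n} (F : Graph n) → IsForest F → (β : ℕ) → IsMatchingNumber F β →
    domSignSum F ≡ -1ℤ ^ (β + n)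
corollary8p4 {n} F forest β β-matchingNumber
  with m , m-matchingNumber , eq ← formula-forest F forest ⊤ = begin
  domSignSum F               ≡⟨ sumℤ-filter-allSubsets (dominating? F) ⟩
  signedSum (dominating? F)  ≡⟨ signedSum-cong (dominating? F) (dominatingIn? F ⊤)
                                                (λ _ → dominating⇔dominatingIn-⊤ F) ⟩
  domSum F ⊤                 ≡⟨ eq ⟩
  -1ℤ ^ m * sign (⊤ {n})     ≡⟨ cong₂ (λ k l → -1ℤ ^ k * -1ℤ ^ l) m≡β (∣⊤∣≡n n) ⟩
  -1ℤ ^ β * -1ℤ ^ n          ≡⟨ ^-distribˡ-+-* -1ℤ β n ⟨
  -1ℤ ^ (β + n)              ∎
  where
  open ≡-Reasoning
  m≡β = matchingNumberIn-⊤ F m-matchingNumber β-matchingNumber
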